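{- Let $H$ be an unweighted directed $t$-vertex graph with $V(H)=\{v_1,\dots,v_t\}$, let $G_1,\dots,G_t$ be vertex-weighted directed graphs without negative cycles, and let $H_w$ be $H$ equipped with vertex weights $w(v_i)=msp(G_i)$. Then $\mathrm{Subst}_H(G_1,\dots,G_t)$ contains a negative cycle if and only if $H_w$ contains a negative cycle. Moreover, if $\mathrm{Subst}_H(G_1,\dots,G_t)$ does not contain a negative cycle, then $msp(H_w)=msp(\mathrm{Subst}_H(G_1,\dots,G_t))$.
   Context: $\mathrm{Subst}_H(G_1,\dots,G_t)$ replaces each $v_i$ by a disjoint copy of $G_i$ (keeping its arcs and vertex weights) and adds all arcs from $V(G_i)$ to $V(G_j)$ whenever $(v_i,v_j)\in E(H)$. The weight of a path (a single vertex counts as a path) or cycle is the sum of its vertex weights; a negative cycle is a directed cycle of negative weight. $msp(G)=\min_P w(P)$ over all paths $P$ of $G$, including single vertices. -}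

module Defs where

open import Data.Nat using (ℕ)
open import Data.Fin using (Fin)
open import Data.Integer using (ℤ; _+_; _<_; _≤_; 0ℤ)
open import Data.List using (List; []; _∷_; _++_; map; foldr)
open import Data.List.Relation.Unary.Linked using (Linked)
open import Data.List.Relation.Unary.Unique.Propositional using (Unique)
open import Data.List.Relation.Unary.All using (All)
open import Data.Product using (Σ; ∃; _×_; _,_)
open import Relation.Nullary using (¬_)
open import Relation.Binary.PropositionalEquality using (_≡_)

record WDigraph : Set₁ where
  field
    n : ℕ
    E : Fin n → Fin n → Set
    w : Fin n → ℤ

record Digraph (t : ℕ) : Set₁ where
  field
    E : Fin t → Fin t → Set

module _ {V : Set} (E : V → V → Set) (w : V → ℤ) where

  weight : List V → ℤ
  weight vs = foldr _+_ 0ℤ (map w vs)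

  -- A path is a nonempty sequence of pairwise distinct vertices with an arc
  -- between consecutive ones (a single vertex is a path).
  IsPath : V → List V → Set
  IsPath x xs = Linked E (x ∷ xs) × Unique (x ∷ xs)

  IsCycle : V → List V → Set
  IsCycle x xs = Linked E (x ∷ xs ++ x ∷ []) × Unique (x ∷ xs)

  HasNegCycle : Set
  HasNegCycle = Σ V λ x → Σ (List V) λ xs → IsCycle x xs × weight (x ∷ xs) < 0ℤ

  IsMsp : ℤ → Set
  IsMsp m = (Σ V λ x → Σ (List V) λ xs → IsPath x xs × weight (x ∷ xs) ≡ m)
          × (∀ x xs → IsPath x xs → m ≤ weight (x ∷ xs))

-- Vertex set, arcs and weights of Subst_H(G_1,…,G_t): vertex (i , u) is the copy
-- of vertex u of G_i; arcs inside copies are kept, and all arcs from copy i to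
-- copy j are added whenever (v_i , v_j) is an arc of H.
module _ {t : ℕ} (H : Digraph t) (G : Fin t → WDigraph) where
  open WDigraph

  SV : Set
  SV = Σ (Fin t) λ i → Fin (n (G i))

  data SE : SV → SV → Set where
    inside : ∀ {i u v} → E (G i) u v → SE (i , u) (i , v)
    across : ∀ {i j u v} → Digraph.E H i j → SE (i , u) (j , v)

  Sw : SV → ℤ
  Sw (i , u) = w (G i) u

-- A walk of Subst_H(G₁,…,G_t) is a sequence of maximal runs inside single copies, joined by
-- arcs of H. A run in copy i is a walk of G_i, which has no negative cycle, so it weighs at
-- least msp(G_i). Collapsing every run to its copy therefore turns walks of the substitution
-- into H_w-walks that are no heavier, and does the same for closed walks that leave their copy
-- once they are rotated to be closed by an arc of H; a closed walk staying inside one copy is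
-- a closed walk of some G_i and cannot be negative. Conversely, replacing each v_i of a path or
-- cycle of H_w by a minimum-weight path of G_i yields a path or cycle of the substitution of the
-- same weight. Walks become paths by cutting out their cycles: either some cycle is negative,
-- or cutting them out makes the walk no heavier.
module Submission where

open import Defs
open import Data.Nat using (ℕ)
open import Data.Fin using (Fin; _≟_)
open import Data.Integer using (ℤ; _+_; _<_; _≤_; 0ℤ; nonNegative)
import Data.Integer.Properties as ℤ
open import Data.List using (List; []; _∷_; _++_; map; foldr; concatMap)
open import Data.List.Properties using (map-∘; ++-identityʳ; ++-assoc; concatMap-++)
open import Data.List.Membership.Propositional using (_∈_)
open import Data.List.Membership.Propositional.Properties using (∈-∃++; ∈-map⁻; ∈-concatMap⁻)
import Data.List.Membership.DecPropositional as DecMembership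
import Data.List.Relation.Unary.Any as Any
open import Data.List.Relation.Unary.All as All using ([]; _∷_)
open import Data.List.Relation.Unary.All.Properties using (¬Any⇒All¬; All¬⇒¬Any; ++⁻ˡ; ++⁻ʳ)
open import Data.List.Relation.Unary.AllPairs using ([]; _∷_)
open import Data.List.Relation.Unary.Linked using (Linked; []; [-]; _∷_)
import Data.List.Relation.Unary.Linked as Linked
import Data.List.Relation.Unary.Linked.Properties as Linked
open import Data.List.Relation.Unary.Unique.Propositional using (Unique)
import Data.List.Relation.Unary.Unique.Propositional.Properties as Unique
open import Data.Product using (Σ; _×_; _,_; proj₁; proj₂)
open import Data.Sum using (_⊎_; inj₁; inj₂)
open import Data.Empty using (⊥; ⊥-elim)
open import Function.Bundles using (_⇔_; mk⇔)
open import Relation.Binary.Definitions using (DecidableEquality)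
open import Relation.Binary.PropositionalEquality
  using (_≡_; refl; sym; trans; cong; cong₂; subst; module ≡-Reasoning)
open import Relation.Nullary using (¬_; yes; no)

last : {A : Set} → A → List A → A
last x []       = x
last x (y ∷ xs) = last y xs

last-++-∷ : {A : Set} → ∀ (x : A) xs y ys → last x (xs ++ y ∷ ys) ≡ last y ys
last-++-∷ x []       y ys = refl
last-++-∷ x (z ∷ xs) y ys = last-++-∷ z xs y ys

last-map : {A B : Set} (f : A → B) → ∀ x xs → last (f x) (map f xs) ≡ f (last x xs)
last-map f x []       = refl
last-map f x (y ∷ xs) = last-map f y xs

module _ {A : Set} {R : A → A → Set} where

  Linked-++⁻ˡ : ∀ xs {ys} → Linked R (xs ++ ys) → Linked R xs
  Linked-++⁻ˡ []           _       = []
  Linked-++⁻ˡ (x ∷ [])     _       = [-]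
  Linked-++⁻ˡ (x ∷ y ∷ xs) (r ∷ l) = r ∷ Linked-++⁻ˡ (y ∷ xs) l

  Linked-++⁻ʳ : ∀ xs {ys} → Linked R (xs ++ ys) → Linked R ys
  Linked-++⁻ʳ []       l = l
  Linked-++⁻ʳ (x ∷ xs) l = Linked-++⁻ʳ xs (Linked.tail l)

  Linked-last⁻ : ∀ x xs {y ys} → Linked R (x ∷ xs ++ y ∷ ys) → R (last x xs) y
  Linked-last⁻ x []       (r ∷ _) = r
  Linked-last⁻ x (z ∷ xs) (_ ∷ l) = Linked-last⁻ z xs l

  Linked-last⁺ : ∀ {x xs y ys} → Linked R (x ∷ xs) → R (last x xs) y → Linked R (y ∷ ys) →
                 Linked R (x ∷ xs ++ y ∷ ys)
  Linked-last⁺ {xs = []}    [-]       r l = r ∷ l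
  Linked-last⁺ {xs = _ ∷ _} (r′ ∷ l′) r l = r′ ∷ Linked-last⁺ l′ r l

  Linked-++-∷⁻ : ∀ x xs {y ys} → Linked R (x ∷ xs ++ y ∷ ys) → Linked R (x ∷ xs ++ y ∷ [])
  Linked-++-∷⁻ x xs l = Linked-last⁺ (Linked-++⁻ˡ (x ∷ xs) l) (Linked-last⁻ x xs l) [-]

  Linked-rotate : ∀ x xs y ys → Linked R (x ∷ xs ++ y ∷ ys ++ x ∷ []) → Linked R (y ∷ ys ++ x ∷ xs)
  Linked-rotate x xs y ys l =
    Linked-last⁺ (Linked-++⁻ˡ (y ∷ ys) back) (Linked-last⁻ y ys back) (Linked-++⁻ˡ (x ∷ xs) l)
    where back = Linked-++⁻ʳ (x ∷ xs) l

module _ {A : Set} where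

  Unique-++⁻ʳ : ∀ (xs : List A) {ys} → Unique (xs ++ ys) → Unique ys
  Unique-++⁻ʳ []       u       = u
  Unique-++⁻ʳ (x ∷ xs) (_ ∷ u) = Unique-++⁻ʳ xs u

  Unique-++-∷⁻ : ∀ (xs : List A) {y ys} → Unique (xs ++ y ∷ ys) → Unique (y ∷ xs)
  Unique-++-∷⁻ []       _        = [] ∷ []
  Unique-++-∷⁻ (x ∷ xs) (x∉ ∷ u) with Unique-++-∷⁻ xs u
  ... | y∉ ∷ uxs = (x≢y ∷ y∉) ∷ (++⁻ˡ xs x∉ ∷ uxs)
    where x≢y = λ y≡x → All.head (++⁻ʳ xs x∉) (sym y≡x)

module _ {V : Set} (E : V → V → Set) (w : V → ℤ) where

  weight-++ : ∀ xs ys → weight E w (xs ++ ys) ≡ weight E w xs + weight E w ys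
  weight-++ []       ys = sym (ℤ.+-identityˡ _)
  weight-++ (x ∷ xs) ys = trans (cong (w x +_) (weight-++ xs ys)) (sym (ℤ.+-assoc (w x) _ _))

  weight-comm-++ : ∀ xs ys → weight E w (xs ++ ys) ≡ weight E w (ys ++ xs)
  weight-comm-++ xs ys = begin
    weight E w (xs ++ ys)         ≡⟨ weight-++ xs ys ⟩
    weight E w xs + weight E w ys ≡⟨ ℤ.+-comm (weight E w xs) _ ⟩
    weight E w ys + weight E w xs ≡⟨ weight-++ ys xs ⟨
    weight E w (ys ++ xs)         ∎
    where open ≡-Reasoning

  PathOfWeight : ℤ → Set
  PathOfWeight m = Σ V λ x → Σ (List V) λ xs → IsPath E w x xs × weight E w (x ∷ xs) ≡ m

  LighterPath : V → List V → Set
  LighterPath x xs = Σ (List V) λ ps →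
    IsPath E w x ps × weight E w (x ∷ ps) ≤ weight E w (x ∷ xs) × last x ps ≡ last x xs

  split-at-revisit : ∀ {x y ps} → x ∈ y ∷ ps → E x y → IsPath E w y ps →
    Σ (List V) λ p → Σ (List V) λ q → IsCycle E w x p × IsPath E w x q
      × weight E w (x ∷ p) + weight E w (x ∷ q) ≡ w x + weight E w (y ∷ ps)
      × last x q ≡ last y ps
  split-at-revisit {x} x∈ e (l , u) with ∈-∃++ x∈
  ... | [] , q , refl =
    [] , q , (e ∷ [-] , [] ∷ []) , (l , u) , cong (_+ weight E w (x ∷ q)) (ℤ.+-identityʳ (w x)) , refl
  ... | y ∷ p , q , refl =
    y ∷ p , q , (e ∷ Linked-++-∷⁻ y p l , Unique-++-∷⁻ (y ∷ p) u) ,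
    (Linked-++⁻ʳ (y ∷ p) l , Unique-++⁻ʳ (y ∷ p) u) ,
    trans (ℤ.+-assoc (w x) (weight E w (y ∷ p)) _) (cong (w x +_) (sym (weight-++ (y ∷ p) (x ∷ q)))) ,
    sym (last-++-∷ y p x q)

  module _ (_≟_ : DecidableEquality V) where
    open DecMembership _≟_ using (_∈?_)

    negCycle⊎lighterPath : ∀ x xs → Linked E (x ∷ xs) → HasNegCycle E w ⊎ LighterPath x xs
    negCycle⊎lighterPath x []       [-]     = inj₂ ([] , ([-] , [] ∷ []) , ℤ.≤-refl , refl)
    negCycle⊎lighterPath x (y ∷ xs) (e ∷ l) with negCycle⊎lighterPath y xs l
    ... | inj₁ negCycle = inj₁ negCycle
    ... | inj₂ (ps , (lp , up) , lighter , same-end) with x ∈? y ∷ ps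
    ...   | no x∉ = inj₂ (y ∷ ps , (e ∷ lp , ¬Any⇒All¬ _ x∉ ∷ up) , ℤ.+-monoʳ-≤ (w x) lighter , same-end)
    ...   | yes x∈ with split-at-revisit x∈ e (lp , up)
    ...     | p , q , cycle , path , split , end with weight E w (x ∷ p) ℤ.<? 0ℤ
    ...       | yes negative   = inj₁ (x , p , cycle , negative)
    ...       | no nonnegative = inj₂ (q , path , lighter′ , trans end same-end)
      where
      open ℤ.≤-Reasoning
      lighter′ : weight E w (x ∷ q) ≤ weight E w (x ∷ y ∷ xs)
      lighter′ = begin
        weight E w (x ∷ q)                      ≤⟨ ℤ.i≤j+i _ _ {{nonNegative (ℤ.≮⇒≥ nonnegative)}} ⟩
        weight E w (x ∷ p) + weight E w (x ∷ q) ≡⟨ split ⟩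
        w x + weight E w (y ∷ ps)               ≤⟨ ℤ.+-monoʳ-≤ (w x) lighter ⟩
        weight E w (x ∷ y ∷ xs)                 ∎

    lighterPath : ¬ HasNegCycle E w → ∀ x xs → Linked E (x ∷ xs) → LighterPath x xs
    lighterPath noNegCycle x xs l with negCycle⊎lighterPath x xs l
    ... | inj₁ negCycle = ⊥-elim (noNegCycle negCycle)
    ... | inj₂ path     = path

    negClosedWalk⇒negCycle : ∀ x xs → Linked E (x ∷ xs) → E (last x xs) x →
                             weight E w (x ∷ xs) < 0ℤ → HasNegCycle E w
    negClosedWalk⇒negCycle x xs l closing negative with negCycle⊎lighterPath x xs l
    ... | inj₁ negCycle = negCycle
    ... | inj₂ (ps , (lp , up) , lighter , same-end) =
      x , ps , (Linked-last⁺ lp (subst (λ z → E z x) (sym same-end) closing) [-] , up) ,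
      ℤ.≤-<-trans lighter negative

    msp≤walk : ¬ HasNegCycle E w → ∀ {m} → IsMsp E w m →
               ∀ x xs → Linked E (x ∷ xs) → m ≤ weight E w (x ∷ xs)
    msp≤walk noNegCycle (_ , m≤) x xs l with lighterPath noNegCycle x xs l
    ... | ps , path , lighter , _ = ℤ.≤-trans (m≤ x ps path) lighter

HasLighterPaths : {V₁ V₂ : Set} (E₁ : V₁ → V₁ → Set) (w₁ : V₁ → ℤ)
                  (E₂ : V₂ → V₂ → Set) (w₂ : V₂ → ℤ) → Set
HasLighterPaths {V₁} E₁ w₁ E₂ w₂ = ∀ x xs → IsPath E₂ w₂ x xs →
  Σ V₁ λ y → Σ (List V₁) λ ys → IsPath E₁ w₁ y ys × weight E₁ w₁ (y ∷ ys) ≤ weight E₂ w₂ (x ∷ xs)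

IsMsp-transfer : ∀ {V₁ V₂ : Set} (E₁ : V₁ → V₁ → Set) (w₁ : V₁ → ℤ) (E₂ : V₂ → V₂ → Set) (w₂ : V₂ → ℤ) →
                 ∀ {m} → HasLighterPaths E₁ w₁ E₂ w₂ → HasLighterPaths E₂ w₂ E₁ w₁ → IsMsp E₁ w₁ m → IsMsp E₂ w₂ m
IsMsp-transfer E₁ w₁ E₂ w₂ lighter₁ lighter₂ ((x , xs , p , p≡m) , m≤) = attained , m≤′
  where
  m≤′ : ∀ y ys → IsPath E₂ w₂ y ys → _ ≤ weight E₂ w₂ (y ∷ ys)
  m≤′ y ys q with lighter₁ y ys q
  ... | x′ , xs′ , p′ , lighter = ℤ.≤-trans (m≤ x′ xs′ p′) lighter

  attained : PathOfWeight E₂ w₂ _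
  attained with lighter₂ x xs p
  ... | y , ys , q , lighter = y , ys , q , ℤ.≤-antisym (subst (_ ≤_) p≡m lighter) (m≤′ y ys q)

module Substitution {t : ℕ} (H : Digraph t) (G : Fin t → WDigraph) (hw : Fin t → ℤ) where
  open WDigraph using (n)

  EH : Fin t → Fin t → Set
  EH = Digraph.E H

  EG : (i : Fin t) → Fin (n (G i)) → Fin (n (G i)) → Set
  EG i = WDigraph.E (G i)

  wG : (i : Fin t) → Fin (n (G i)) → ℤ
  wG i = WDigraph.w (G i)

  S : Set
  S = SV H G

  ES : S → S → Set
  ES = SE H G

  wS : S → ℤ
  wS = Sw H G

  weightH : List (Fin t) → ℤ
  weightH = weight EH hw

  weightG : (i : Fin t) → List (Fin (n (G i))) → ℤ
  weightG i = weight (EG i) (wG i)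

  weightS : List S → ℤ
  weightS = weight ES wS

  embed : (i : Fin t) → Fin (n (G i)) → S
  embed i u = i , u

  weight-embed : ∀ i us → weightS (map (embed i) us) ≡ weightG i us
  weight-embed i us = cong (foldr _+_ 0ℤ) (sym (map-∘ us))

  Linked-embed : ∀ i {us} → Linked (EG i) us → Linked ES (map (embed i) us)
  Linked-embed i l = Linked.map⁺ (Linked.map inside l)

  module Lifting (minPath : ∀ i → PathOfWeight (EG i) (wG i) (hw i)) where

    start : (i : Fin t) → Fin (n (G i))
    start i = proj₁ (minPath i)

    rest : (i : Fin t) → List (Fin (n (G i)))
    rest i = proj₁ (proj₂ (minPath i))

    IsPath-minPath : ∀ i → IsPath (EG i) (wG i) (start i) (rest i)
    IsPath-minPath i = proj₁ (proj₂ (proj₂ (minPath i)))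

    block : Fin t → List S
    block i = map (embed i) (start i ∷ rest i)

    lift : List (Fin t) → List S
    lift = concatMap block

    weight-lift : ∀ is → weightS (lift is) ≡ weightH is
    weight-lift []       = refl
    weight-lift (i ∷ is) = begin
      weightS (block i ++ lift is)              ≡⟨ weight-++ ES wS (block i) (lift is) ⟩
      weightS (block i) + weightS (lift is)     ≡⟨ cong₂ _+_ (weight-embed i (start i ∷ rest i)) (weight-lift is) ⟩
      weightG i (start i ∷ rest i) + weightH is ≡⟨ cong (_+ weightH is) (proj₂ (proj₂ (proj₂ (minPath i)))) ⟩
      hw i + weightH is                         ∎
      where open ≡-Reasoning

    Linked-lift : ∀ {is} → Linked EH is → Linked ES (lift is)
    Linked-lift []        = []
    Linked-lift ([-] {i}) =
      subst (Linked ES) (sym (++-identityʳ (block i))) (Linked-embed i (proj₁ (IsPath-minPath i)))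
    Linked-lift {i ∷ j ∷ _} (r ∷ l) =
      Linked-last⁺ (Linked-embed i (proj₁ (IsPath-minPath i)))
                   (subst (λ z → ES z (embed j (start j))) (sym (last-map (embed i) (start i) (rest i))) (across r))
                   (Linked-lift l)

    ∈-lift⁻ : ∀ {v} is → v ∈ lift is → proj₁ v ∈ is
    ∈-lift⁻ is v∈ = Any.map copy-of (∈-concatMap⁻ block {xs = is} v∈)
      where
      copy-of : ∀ {v i} → v ∈ block i → proj₁ v ≡ i
      copy-of v∈ with ∈-map⁻ (embed _) v∈
      ... | _ , _ , refl = refl

    Unique-lift : ∀ {is} → Unique is → Unique (lift is)
    Unique-lift []                = []
    Unique-lift {i ∷ is} (i∉ ∷ u) =
      Unique.++⁺ (Unique.map⁺ embed-injective (proj₂ (IsPath-minPath i))) (Unique-lift u) disjoint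
      where
      embed-injective : ∀ {u v} → embed i u ≡ embed i v → u ≡ v
      embed-injective refl = refl
      disjoint : ∀ {v} → v ∈ block i × v ∈ lift is → ⊥
      disjoint (v∈block , v∈lift) with ∈-map⁻ (embed i) v∈block
      ... | _ , _ , refl = All¬⇒¬Any i∉ (∈-lift⁻ is v∈lift)

    IsPath-lift : ∀ {i is} → IsPath EH hw i is → IsPath ES wS (embed i (start i)) (map (embed i) (rest i) ++ lift is)
    IsPath-lift (l , u) = Linked-lift l , Unique-lift u

    lift-lighterPaths : HasLighterPaths ES wS EH hw
    lift-lighterPaths i is p = embed i (start i) , _ , IsPath-lift p , ℤ.≤-reflexive (weight-lift (i ∷ is))

    negCycleH⇒negCycleS : HasNegCycle EH hw → HasNegCycle ES wS
    negCycleH⇒negCycleS (x , xs , (l , u) , negative) =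
      embed x (start x) , map (embed x) (rest x) ++ lift xs ,
      (Linked-++-∷⁻ (embed x (start x)) (map (embed x) (rest x) ++ lift xs)
         (subst (Linked ES) (concatMap-++ block (x ∷ xs) (x ∷ [])) (Linked-lift l)) ,
       Unique-lift u) ,
      subst (_< 0ℤ) (sym (weight-lift (x ∷ xs))) negative

  module Projection (hw≤walk : ∀ i u us → Linked (EG i) (u ∷ us) → hw i ≤ weightG i (u ∷ us)) where

    ProjectedWalk : (i : Fin t) → Fin (n (G i)) → List S → Set
    ProjectedWalk i u vs = Σ (List (Fin t)) λ hs →
      Linked EH (i ∷ hs) × weightH (i ∷ hs) ≤ weightS (embed i u ∷ vs)
      × proj₁ (last (embed i u) vs) ≡ last i hs

    -- The run in the current copy is only bounded by hw i once it is complete, so it is kept.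
    RunThenProjectedWalk : (i : Fin t) → Fin (n (G i)) → List S → Set
    RunThenProjectedWalk i u vs = Σ (List (Fin (n (G i)))) λ us → Σ (List (Fin t)) λ hs →
      Linked (EG i) (u ∷ us) × Linked EH (i ∷ hs)
      × weightG i (u ∷ us) + weightH hs ≤ weightS (embed i u ∷ vs)
      × proj₁ (last (embed i u) vs) ≡ last i hs

    run-then-project : ∀ i u vs → Linked ES (embed i u ∷ vs) → RunThenProjectedWalk i u vs
    run-then-project i u [] [-] = [] , [] , [-] , [-] , ℤ.≤-reflexive (ℤ.+-identityʳ _) , refl
    run-then-project i u ((i , v) ∷ vs) (inside e ∷ l) with run-then-project i v vs l
    ... | us , hs , lg , lh , bound , end = v ∷ us , hs , e ∷ lg , lh , bound′ , end
      where
      open ℤ.≤-Reasoning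
      bound′ : wG i u + weightG i (v ∷ us) + weightH hs ≤ wG i u + weightS (embed i v ∷ vs)
      bound′ = begin
        wG i u + weightG i (v ∷ us) + weightH hs   ≡⟨ ℤ.+-assoc (wG i u) _ _ ⟩
        wG i u + (weightG i (v ∷ us) + weightH hs) ≤⟨ ℤ.+-monoʳ-≤ (wG i u) bound ⟩
        wG i u + weightS (embed i v ∷ vs)          ∎
    run-then-project i u ((j , v) ∷ vs) (across r ∷ l) with run-then-project j v vs l
    ... | us , hs , lg , lh , bound , end = [] , j ∷ hs , [-] , r ∷ lh , bound′ , end
      where
      open ℤ.≤-Reasoning
      bound′ : wG i u + 0ℤ + (hw j + weightH hs) ≤ wG i u + weightS (embed j v ∷ vs)
      bound′ = begin
        wG i u + 0ℤ + (hw j + weightH hs)          ≡⟨ cong (_+ (hw j + weightH hs)) (ℤ.+-identityʳ (wG i u)) ⟩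
        wG i u + (hw j + weightH hs)               ≤⟨ ℤ.+-monoʳ-≤ (wG i u)
                                                       (ℤ.+-monoˡ-≤ (weightH hs) (hw≤walk j v us lg)) ⟩
        wG i u + (weightG j (v ∷ us) + weightH hs) ≤⟨ ℤ.+-monoʳ-≤ (wG i u) bound ⟩
        wG i u + weightS (embed j v ∷ vs)          ∎

    project : ∀ i u vs → Linked ES (embed i u ∷ vs) → ProjectedWalk i u vs
    project i u vs l with run-then-project i u vs l
    ... | us , hs , lg , lh , bound , end =
      hs , lh , ℤ.≤-trans (ℤ.+-monoˡ-≤ (weightH hs) (hw≤walk i u us lg)) bound , end

    project-lighterPaths : ¬ HasNegCycle EH hw → HasLighterPaths EH hw ES wS
    project-lighterPaths noNegCycle (i , u) vs (l , _) with project i u vs l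
    ... | hs , lh , bound , _ with lighterPath EH hw _≟_ noNegCycle i hs lh
    ... | ps , path , lighter , _ = i , ps , path , ℤ.≤-trans lighter bound

    negClosedWalk-across⇒negCycleH : ∀ i u vs → Linked ES (embed i u ∷ vs) → EH (proj₁ (last (embed i u) vs)) i →
                                      weightS (embed i u ∷ vs) < 0ℤ → HasNegCycle EH hw
    negClosedWalk-across⇒negCycleH i u vs l closing negative with project i u vs l
    ... | hs , lh , bound , end =
      negClosedWalk⇒negCycle EH hw _≟_ i hs lh (subst (λ z → EH z i) end closing) (ℤ.≤-<-trans bound negative)

    InsideCopy : (i : Fin t) → Fin (n (G i)) → Fin (n (G i)) → List S → Set
    InsideCopy i u u₀ vs = Σ (List (Fin (n (G i)))) λ us →
      vs ≡ map (embed i) us × Linked (EG i) (u ∷ us) × EG i (last u us) u₀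

    AcrossArcIn : S → List S → Set
    AcrossArcIn c vs = Σ (List S) λ as → Σ S λ d → Σ (List S) λ bs →
      vs ≡ as ++ d ∷ bs × EH (proj₁ (last c as)) (proj₁ d)

    inside⊎across : ∀ i u u₀ vs → Linked ES (embed i u ∷ vs ++ embed i u₀ ∷ []) →
      InsideCopy i u u₀ vs ⊎ AcrossArcIn (embed i u) vs ⊎ EH (proj₁ (last (embed i u) vs)) i
    inside⊎across i u u₀ []             (inside e ∷ [-]) = inj₁ ([] , refl , [-] , e)
    inside⊎across i u u₀ []             (across r ∷ [-]) = inj₂ (inj₂ r)
    inside⊎across i u u₀ ((j , v) ∷ vs) (across r ∷ _)   = inj₂ (inj₁ ([] , (j , v) , vs , refl , r))
    inside⊎across i u u₀ ((i , v) ∷ vs) (inside e ∷ l) with inside⊎across i v u₀ vs l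
    ... | inj₁ (us , refl , lg , closing)      = inj₁ (v ∷ us , refl , e ∷ lg , closing)
    ... | inj₂ (inj₁ (as , d , bs , refl , r)) = inj₂ (inj₁ (embed i v ∷ as , d , bs , refl , r))
    ... | inj₂ (inj₂ r)                        = inj₂ (inj₂ r)

    negClosedWalkS⇒negCycleH : (∀ i → ¬ HasNegCycle (EG i) (wG i)) →
      ∀ c cs → Linked ES (c ∷ cs ++ c ∷ []) → weightS (c ∷ cs) < 0ℤ → HasNegCycle EH hw
    negClosedWalkS⇒negCycleH noNegCycleG (i , u) cs l negative with inside⊎across i u u cs l
    ... | inj₁ (us , refl , lg , closing) =
      ⊥-elim (noNegCycleG i (negClosedWalk⇒negCycle (EG i) (wG i) _≟_ u us lg closing
                               (subst (_< 0ℤ) (weight-embed i (u ∷ us)) negative)))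
    ... | inj₂ (inj₂ r) = negClosedWalk-across⇒negCycleH i u cs (Linked-++⁻ˡ (embed i u ∷ cs) l) r negative
    ... | inj₂ (inj₁ (as , (j , v) , bs , refl , r)) =
      negClosedWalk-across⇒negCycleH j v (bs ++ embed i u ∷ as)
        (Linked-rotate (embed i u) as (j , v) bs (subst (λ z → Linked ES (embed i u ∷ z)) (++-assoc as _ _) l))
        (subst (λ z → EH (proj₁ z) j) (sym (last-++-∷ (j , v) bs (embed i u) as)) r)
        (subst (_< 0ℤ) (weight-comm-++ ES wS (embed i u ∷ as) ((j , v) ∷ bs)) negative)

lemma18 : {t : ℕ} (H : Digraph t) (G : Fin t → WDigraph)
    → (∀ i → ¬ HasNegCycle (WDigraph.E (G i)) (WDigraph.w (G i)))
    → (hw : Fin t → ℤ)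
    → (∀ i → IsMsp (WDigraph.E (G i)) (WDigraph.w (G i)) (hw i))
    → (HasNegCycle (SE H G) (Sw H G) ⇔ HasNegCycle (Digraph.E H) hw)
      × (¬ HasNegCycle (SE H G) (Sw H G)
         → ∀ m → IsMsp (Digraph.E H) hw m ⇔ IsMsp (SE H G) (Sw H G) m)
lemma18 H G noNegCycleG hw msp = mk⇔ negCycleS⇒negCycleH negCycleH⇒negCycleS , same-msp
  where
  open Substitution H G hw
  open Lifting (λ i → proj₁ (msp i))
  open Projection (λ i → msp≤walk (EG i) (wG i) _≟_ (noNegCycleG i) (msp i))

  negCycleS⇒negCycleH : HasNegCycle ES wS → HasNegCycle EH hw
  negCycleS⇒negCycleH (c , cs , (l , _) , negative) = negClosedWalkS⇒negCycleH noNegCycleG c cs l negative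

  same-msp : ¬ HasNegCycle ES wS → ∀ m → IsMsp EH hw m ⇔ IsMsp ES wS m
  same-msp noNegCycleS m = mk⇔ (IsMsp-transfer EH hw ES wS (project-lighterPaths noNegCycleH) lift-lighterPaths)
                                (IsMsp-transfer ES wS EH hw lift-lighterPaths (project-lighterPaths noNegCycleH))
    where
    noNegCycleH : ¬ HasNegCycle EH hw
    noNegCycleH negCycle = noNegCycleS (negCycleH⇒negCycleS negCycle)
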